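{- Let $(B,+,0)$ be a uniquely $2$-divisible K-loop. Then $(B,s)$ with $s(x,y)=y+(-x+y)$ is a symétron.
   Context: A K-loop is a structure $(B,+,0)$ with $0+a=a+0=a$, where for all $a,b$ the equations $x+a=b$ and $a+y=b$ have unique solutions, satisfying the Bol condition $a+(b+(a+c))=(a+(b+a))+c$ and the automorphic inverse property $-(a+b)=-a-b$. It is uniquely $2$-divisible if $x\mapsto x+x$ is a bijection. A symétron is a set $S$ with a binary operation $s$ such that for all $x,y,z$: $s(x,x)=x$; $s(s(x,y),y)=x$; $s(s(x,z),s(y,z))=s(s(x,y),z)$; and for all $x,y$ there is a unique $z$ with $s(x,z)=y$. -}

module Defs where

open import Level using (Level; suc; _⊔_)
open import Data.Product using (Σ; _×_; _,_; proj₁; ∃!)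
open import Relation.Binary.PropositionalEquality using (_≡_)
open import Function.Definitions using (Bijective)

-- The inverse -a is the unique solution
-- y of a + y = 0 (in a Bol loop this is a two-sided inverse).
record IsLoop {a} (B : Set a) (_+_ : B → B → B) (0# : B) : Set a where
  field
    identityˡ : ∀ x → 0# + x ≡ x
    identityʳ : ∀ x → x + 0# ≡ x
    solveˡ    : ∀ x y → ∃! _≡_ (λ z → z + x ≡ y)
    solveʳ    : ∀ x y → ∃! _≡_ (λ z → x + z ≡ y)

  -_ : B → B
  - x = proj₁ (solveʳ x 0#)

record IsKLoop {a} (B : Set a) (_+_ : B → B → B) (0# : B) : Set a where
  field
    isLoop : IsLoop B _+_ 0#
  open IsLoop isLoop public
  field
    bol           : ∀ x y z → x + (y + (x + z)) ≡ (x + (y + x)) + z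
    automorphicInv : ∀ x y → - (x + y) ≡ (- x) + (- y)

UniquelyTwoDivisible : ∀ {a} {B : Set a} → (B → B → B) → Set a
UniquelyTwoDivisible {B = B} _+_ = Bijective _≡_ _≡_ (λ (x : B) → x + x)

record IsSymetron {a} (S : Set a) (s : S → S → S) : Set a where
  field
    idem    : ∀ x → s x x ≡ x
    invol   : ∀ x y → s (s x y) y ≡ x
    distrib : ∀ x y z → s (s x z) (s y z) ≡ s (s x y) z
    uniqueSolve : ∀ x y → ∃! _≡_ (λ z → s x z ≡ y)

{-# OPTIONS --safe #-}
-- Write x ⋈ w for the sandwich x + (w + x), so that s x y = y ⋈ (- x).
-- The Bol identity reads (x ⋈ y) + z = x + (y + (x + z)); together with the
-- inverse properties it makes w ↦ - r ⋈ w and w ↦ r ⋈ w mutually inverse,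
-- and the automorphic inverse property gives - (x ⋈ y) = - x ⋈ - y.  For unique
-- solvability, pick r with r + r = - x: then z ↦ s x z is conjugate under
-- w ↦ - r ⋈ w to the doubling map, which is a bijection.
module Submission where

open import Defs
open import Data.Product using (_,_; proj₁; proj₂; ∃!)
open import Function.Definitions using (Bijective)
open import Relation.Binary.PropositionalEquality

conjugate-of-bijective⇒∃!-preimage :
  ∀ {a} {A : Set a} {f d ψ φ : A → A} →
  Bijective _≡_ _≡_ d →
  (∀ w → φ (ψ w) ≡ w) → (∀ y → ψ (φ y) ≡ y) →
  (∀ w → f (ψ w) ≡ ψ (d w)) →
  ∀ y → ∃! _≡_ (λ z → f z ≡ y)
conjugate-of-bijective⇒∃!-preimage {A = A} {f} {d} {ψ} {φ} (d-inj , d-surj) φψ ψφ f∘ψ y =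
  ψ h , f[ψh]≡y , unique
  where
  open ≡-Reasoning
  h : A
  h = proj₁ (d-surj (φ y))
  dh≡φy : d h ≡ φ y
  dh≡φy = proj₂ (d-surj (φ y)) refl

  f[ψh]≡y : f (ψ h) ≡ y
  f[ψh]≡y = begin
    f (ψ h)   ≡⟨ f∘ψ h ⟩
    ψ (d h)   ≡⟨ cong ψ dh≡φy ⟩
    ψ (φ y)   ≡⟨ ψφ y ⟩
    y         ∎

  unique : ∀ {z} → f z ≡ y → ψ h ≡ z
  unique {z} fz≡y = trans (cong ψ h≡φz) (ψφ z)
    where
    h≡φz : h ≡ φ z
    h≡φz = d-inj (begin
      d h                   ≡⟨ dh≡φy ⟩
      φ y                   ≡⟨ cong φ (sym fz≡y) ⟩
      φ (f z)               ≡⟨ cong (λ v → φ (f v)) (sym (ψφ z)) ⟩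
      φ (f (ψ (φ z)))       ≡⟨ cong φ (f∘ψ (φ z)) ⟩
      φ (ψ (d (φ z)))       ≡⟨ φψ (d (φ z)) ⟩
      d (φ z)               ∎)

module LoopProperties {a} {B : Set a} {plus : B → B → B} {0# : B}
                      (L : IsLoop B plus 0#) where
  open IsLoop L

  infixl 6 _+_
  _+_ : B → B → B
  _+_ = plus

  +-inverseʳ : ∀ x → x + - x ≡ 0#
  +-inverseʳ x = proj₁ (proj₂ (solveʳ x 0#))

  +-cancelˡ : ∀ x {y z} → x + y ≡ x + z → y ≡ z
  +-cancelˡ x {y} {z} eq = trans (sym (unique eq)) (unique refl)
    where
    unique : ∀ {w} → x + w ≡ x + z → proj₁ (solveʳ x (x + z)) ≡ w
    unique = proj₂ (proj₂ (solveʳ x (x + z)))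

  +-cancelʳ : ∀ x {y z} → y + x ≡ z + x → y ≡ z
  +-cancelʳ x {y} {z} eq = trans (sym (unique eq)) (unique refl)
    where
    unique : ∀ {w} → w + x ≡ z + x → proj₁ (solveˡ x (z + x)) ≡ w
    unique = proj₂ (proj₂ (solveˡ x (z + x)))

  -‿unique : ∀ {x y} → x + y ≡ 0# → - x ≡ y
  -‿unique {x} = proj₂ (proj₂ (solveʳ x 0#))

module LeftBolLoopProperties {a} {B : Set a} {plus : B → B → B} {0# : B}
                             (L : IsLoop B plus 0#)
                             (bol : ∀ x y z → plus x (plus y (plus x z)) ≡ plus (plus x (plus y x)) z)
                             where
  open IsLoop L
  open LoopProperties L public
  open ≡-Reasoning

  infix 7 _⋈_
  _⋈_ : B → B → B
  x ⋈ w = x + (w + x)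

  ⋈-+ : ∀ x y z → x ⋈ y + z ≡ x + (y + (x + z))
  ⋈-+ x y z = sym (bol x y z)

  +-inverseˡ : ∀ x → - x + x ≡ 0#
  +-inverseˡ x = +-cancelˡ x (+-cancelʳ (- x) (begin
    (x + (- x + x)) + - x   ≡⟨ ⋈-+ x (- x) (- x) ⟩
    x + (- x + (x + - x))   ≡⟨ cong (λ v → x + (- x + v)) (+-inverseʳ x) ⟩
    x + (- x + 0#)          ≡⟨ cong (x +_) (identityʳ (- x)) ⟩
    x + - x                 ≡⟨ cong (_+ - x) (sym (identityʳ x)) ⟩
    (x + 0#) + - x          ∎))

  -x+[x+y]≡y : ∀ x y → - x + (x + y) ≡ y
  -x+[x+y]≡y x y = +-cancelˡ x (begin
    x + (- x + (x + y))   ≡⟨ bol x (- x) y ⟩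
    (x + (- x + x)) + y   ≡⟨ cong (λ v → (x + v) + y) (+-inverseˡ x) ⟩
    (x + 0#) + y          ≡⟨ cong (_+ y) (identityʳ x) ⟩
    x + y                 ∎)

  -‿involutive : ∀ x → - - x ≡ x
  -‿involutive x = -‿unique (+-inverseˡ x)

  x+[-x+y]≡y : ∀ x y → x + (- x + y) ≡ y
  x+[-x+y]≡y x y = subst (λ v → v + (- x + y) ≡ y) (-‿involutive x) (-x+[x+y]≡y (- x) y)

  +-alternativeˡ : ∀ x y → (x + x) + y ≡ x + (x + y)
  +-alternativeˡ x y = begin
    (x + x) + y          ≡⟨ cong (λ v → (x + v) + y) (sym (identityˡ x)) ⟩
    x ⋈ 0# + y           ≡⟨ ⋈-+ x 0# y ⟩
    x + (0# + (x + y))   ≡⟨ cong (x +_) (identityˡ (x + y)) ⟩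
    x + (x + y)          ∎

  ⋈-inverse : ∀ x w → - x ⋈ (x ⋈ w) ≡ w
  ⋈-inverse x w = begin
    - x + ((x + (w + x)) + - x)   ≡⟨ cong (- x +_) (⋈-+ x w (- x)) ⟩
    - x + (x + (w + (x + - x)))   ≡⟨ cong (λ v → - x + (x + (w + v))) (+-inverseʳ x) ⟩
    - x + (x + (w + 0#))          ≡⟨ cong (λ v → - x + (x + v)) (identityʳ w) ⟩
    - x + (x + w)                 ≡⟨ -x+[x+y]≡y x w ⟩
    w                             ∎

  ⋈-inverse˘ : ∀ x w → x ⋈ (- x ⋈ w) ≡ w
  ⋈-inverse˘ x w = subst (λ v → v ⋈ (- x ⋈ w) ≡ w) (-‿involutive x) (⋈-inverse (- x) w)

  ⋈-conjugates-doubling : ∀ r h → (- r ⋈ h) ⋈ (r + r) ≡ - r ⋈ (h + h)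
  ⋈-conjugates-doubling r h = begin
    z + ((r + r) + z)              ≡⟨ cong (z +_) (+-alternativeˡ r z) ⟩
    z + (r + (r + z))              ≡⟨ cong (λ v → z + (r + v)) (x+[-x+y]≡y r (h + - r)) ⟩
    z + (r + (h + - r))            ≡⟨ ⋈-+ (- r) h (r + (h + - r)) ⟩
    - r + (h + (- r + (r + (h + - r))))
                                   ≡⟨ cong (λ v → - r + (h + v)) (-x+[x+y]≡y r (h + - r)) ⟩
    - r + (h + (h + - r))          ≡⟨ cong (- r +_) (sym (+-alternativeˡ h (- r))) ⟩
    - r + ((h + h) + - r)          ∎
    where
    z : B
    z = - r ⋈ h

module KLoopSymetron {a} {B : Set a} {plus : B → B → B} {0# : B}
                     (K : IsKLoop B plus 0#) where
  open IsKLoop K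
  open LeftBolLoopProperties isLoop bol
  open ≡-Reasoning

  s : B → B → B
  s x y = y ⋈ (- x)

  -‿⋈ : ∀ x y → - (x ⋈ y) ≡ - x ⋈ - y
  -‿⋈ x y = trans (automorphicInv x (y + x)) (cong (- x +_) (automorphicInv y x))

  -‿s : ∀ x y → - s x y ≡ - y ⋈ x
  -‿s x y = trans (-‿⋈ y (- x)) (cong (λ v → - y ⋈ v) (-‿involutive x))

  s-idem : ∀ x → s x x ≡ x
  s-idem x = trans (cong (x +_) (+-inverseˡ x)) (identityʳ x)

  s-invol : ∀ x y → s (s x y) y ≡ x
  s-invol x y = begin
    y + (- s x y + y)           ≡⟨ cong (λ v → y + (v + y)) (-‿s x y) ⟩
    y + ((- y ⋈ x) + y)         ≡⟨ cong (y +_) (⋈-+ (- y) x y) ⟩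
    y + (- y + (x + (- y + y))) ≡⟨ cong (λ v → y + (- y + (x + v))) (+-inverseˡ y) ⟩
    y + (- y + (x + 0#))        ≡⟨ cong (λ v → y + (- y + v)) (identityʳ x) ⟩
    y + (- y + x)               ≡⟨ x+[-x+y]≡y y x ⟩
    x                           ∎

  s-distrib : ∀ x y z → s (s x z) (s y z) ≡ s (s x y) z
  s-distrib x y z = begin
    (z ⋈ - y) + (- s x z + z ⋈ - y)
      ≡⟨ ⋈-+ z (- y) _ ⟩
    z + (- y + (z + (- s x z + z ⋈ - y)))
      ≡⟨ cong (λ v → z + (- y + (z + (v + z ⋈ - y)))) (-‿s x z) ⟩
    z + (- y + (z + ((- z ⋈ x) + z ⋈ - y)))
      ≡⟨ cong (λ v → z + (- y + (z + v))) (⋈-+ (- z) x (z ⋈ - y)) ⟩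
    z + (- y + (z + (- z + (x + (- z + (z + (- y + z)))))))
      ≡⟨ cong (λ v → z + (- y + (z + (- z + (x + v))))) (-x+[x+y]≡y z (- y + z)) ⟩
    z + (- y + (z + (- z + (x + (- y + z)))))
      ≡⟨ cong (λ v → z + (- y + v)) (x+[-x+y]≡y z (x + (- y + z))) ⟩
    z + (- y + (x + (- y + z)))
      ≡⟨ cong (z +_) (sym (⋈-+ (- y) x z)) ⟩
    z + ((- y ⋈ x) + z)
      ≡⟨ cong (λ v → z + (v + z)) (sym (-‿s x y)) ⟩
    z + (- s x y + z)
      ∎

  s-uniqueSolve : UniquelyTwoDivisible plus → ∀ x y → ∃! _≡_ (λ z → s x z ≡ y)
  s-uniqueSolve double-bijective x =
    conjugate-of-bijective⇒∃!-preimage double-bijective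
      (⋈-inverse˘ r) (⋈-inverse r) s∘[-r⋈]≗[-r⋈]∘double
    where
    r : B
    r = proj₁ (proj₂ double-bijective (- x))
    r+r≡-x : r + r ≡ - x
    r+r≡-x = proj₂ (proj₂ double-bijective (- x)) refl

    s∘[-r⋈]≗[-r⋈]∘double : ∀ h → s x (- r ⋈ h) ≡ - r ⋈ (h + h)
    s∘[-r⋈]≗[-r⋈]∘double h =
      trans (cong ((- r ⋈ h) ⋈_) (sym r+r≡-x)) (⋈-conjugates-doubling r h)

  isSymetron : UniquelyTwoDivisible plus → IsSymetron B s
  isSymetron double-bijective = record
    { idem        = s-idem
    ; invol       = s-invol
    ; distrib     = s-distrib
    ; uniqueSolve = s-uniqueSolve double-bijective
    }

mainTheorem7 : ∀ {a} (B : Set a) (_+_ : B → B → B) (0# : B)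
    → (K : IsKLoop B _+_ 0#)
    → UniquelyTwoDivisible _+_
    → IsSymetron B (λ x y → y + (IsKLoop.-_ K x + y))
mainTheorem7 B _+_ 0# K = KLoopSymetron.isSymetron K
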